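{- Let $\mathrm{D}$ be one of $\mathrm{D.LE}$, $\mathrm{cfD.LE}$, an extension $\mathrm{D.LE}'$ of $\mathrm{D.LE}$ by analytic structural rules, or its cut-free version $\mathrm{cfD.LE}'$, and let $\mathbb{F}_{\mathrm{D}}=(W,U,N,\{R_f\},\{R_g\})$ be a functional $\mathrm{D}$-frame. For every sequent $x\Rightarrow y$, if $\mathbb{F}_{\mathrm{D}}^+\models x\Rightarrow y$ then $x\,N\,y$.
   Context: LE-signature $\mathcal{L}=\mathcal{L}(\mathcal{F},\mathcal{G})$: disjoint sets of connectives, each $h$ with arity $n_h$ and order type $\varepsilon_h\in\{1,\partial\}^{n_h}$ ($1^\partial=\partial,\partial^\partial=1$). Formulas: $\varphi::=p\mid\bot\mid\top\mid\varphi\wedge\varphi\mid\varphi\vee\varphi\mid f(\bar\varphi)\mid g(\bar\varphi)$. $\bar a^i_b$: $\bar a$ with $i$-th entry replaced by $b$. Residual symbols $f^\sharp_i$, $g^\flat_i$; $\mathcal{F}^*$ = $\mathcal{F}$ plus $f^\sharp_i$ with $\varepsilon_f(i)=\partial$ plus $g^\flat_i$ with $\varepsilon_g(i)=1$; $\mathcal{G}^*$ = $\mathcal{G}$ plus $f^\sharp_i$ with $\varepsilon_f(i)=1$ plus $g^\flat_i$ with $\varepsilon_g(i)=\partial$; $\varepsilon_{f^\sharp_i}(i)=\varepsilon_f(i)$, for $j\ne i$ $\varepsilon_{f^\sharp_i}(j)=\varepsilon_f(j)^\partial$ if $\varepsilon_f(i)=1$ and $=\varepsilon_f(j)$ otherwise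 (likewise $g^\flat_i$). Structures: sorts $\mathsf{Str}_\mathcal{F},\mathsf{Str}_\mathcal{G}$ containing all formulas, closed under $\mathsf{F}_h$ ($h\in\mathcal{F}^*$, into $\mathsf{Str}_\mathcal{F}$, argument $i$ in $\mathsf{Str}_\mathcal{F}$ if $\varepsilon_h(i)=1$, $\mathsf{Str}_\mathcal{G}$ if $\partial$) and $\mathsf{G}_h$ ($h\in\mathcal{G}^*$, into $\mathsf{Str}_\mathcal{G}$, dually). Sequents $x\Rightarrow y$, $x\in\mathsf{Str}_\mathcal{F}$, $y\in\mathsf{Str}_\mathcal{G}$. Rules of $\mathrm{D.LE}$: (Id) $p\Rightarrow p$; (Cut) $x\Rightarrow\varphi$, $\varphi\Rightarrow y$ / $x\Rightarrow y$; invertible display rules $\mathsf{F}_f(\bar x)\Rightarrow y$ iff $x_i\Rightarrow\mathsf{G}_{f^\sharp_i}(\bar x^i_y)$ ($\varepsilon_f(i)=1$), iff $\mathsf{F}_{f^\sharp_i}(\bar x^i_y)\Rightarrow x_i$ ($\varepsilon_f(i)=\partial$); $x\Rightarrow\mathsf{G}_g(\bar y)$ iff $\mathsf{F}_{g^\flat_i}(\bar y^i_x)\Rightarrow y_i$ ($\varepsilon_g(i)=1$), iff $y_i\Rightarrow\mathsf{G}_{g^\flat_i}(\bar y^i_x)$ ($\varepsilon_g(i)=\partial$); $\bot\Rightarrow y$; $x\Rightarrow\top$; $\varphi\Rightarrow y$ / $\varphi\wedge\psi\Rightarrow y$ and $\psi\wedge\varphi\Rightarrow y$; $x\Rightarrow\varphi$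 / $x\Rightarrow\varphi\vee\psi$ and $x\Rightarrow\psi\vee\varphi$; $x\Rightarrow\varphi$, $x\Rightarrow\psi$ / $x\Rightarrow\varphi\wedge\psi$; $\varphi\Rightarrow y$, $\psi\Rightarrow y$ / $\varphi\vee\psi\Rightarrow y$; $\mathsf{F}_f(\bar\varphi)\Rightarrow y$ / $f(\bar\varphi)\Rightarrow y$; $x_i\Rightarrow\varphi_i$ ($\varepsilon_f(i)=1$), $\varphi_j\Rightarrow x_j$ ($\varepsilon_f(j)=\partial$) / $\mathsf{F}_f(\bar x)\Rightarrow f(\bar\varphi)$; $x\Rightarrow\mathsf{G}_g(\bar\psi)$ / $x\Rightarrow g(\bar\psi)$; $\psi_i\Rightarrow y_i$ ($\varepsilon_g(i)=1$), $y_j\Rightarrow\psi_j$ ($\varepsilon_g(j)=\partial$) / $g(\bar\psi)\Rightarrow\mathsf{G}_g(\bar y)$. $\mathrm{cfD.LE}$: without Cut. Analytic structural rule: structural rule scheme satisfying Belnap's conditions C1–C7 for proper display calculi. Polarity notation: $X^\uparrow=\{u:xNu\ \forall x\in X\}$, $Y^\downarrow=\{w:wNy\ \forall y\in Y\}$; stable sets $X=X^{\uparrow\downarrow}$. $W^\varepsilon=\prod_iW^{\varepsilon(i)}$ ($W^1=W$, $W^\partial=U$), $U^\varepsilon$ dually. For $S\subseteq A\times B_1\times\cdots\times B_n$: $S^{(0)}[C_1,..,C_n]=\{a:(a,\bar b)\in S\ \forall b_j\in C_j\}$. A functional $\mathrm{D}$-frame is $(W,U,N,\{R_f\},\{R_g\})$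 with $W=\mathsf{Str}_\mathcal{F}$, $U=\mathsf{Str}_\mathcal{G}$, $N\subseteq W\times U$ closed under all rule instances of $\mathrm{D}$ (if $x_kNy_k$ for all premises then $x_0Ny_0$ for the conclusion; zero-premise rules give $x_0Ny_0$), $R_f(y,\bar x)$ iff $\mathsf{F}_f(\bar x)Ny$, $R_g(x,\bar y)$ iff $xN\mathsf{G}_g(\bar y)$. Complex algebra $\mathbb{F}_{\mathrm{D}}^+$: stable subsets of $W$ under inclusion, with $f(X_1,..,X_n)=(R_f^{(0)}[X'_1,..,X'_n])^\downarrow$ ($X'_i=X_i$ if $\varepsilon_f(i)=1$, $X_i^\uparrow$ if $\partial$) and $g(X_1,..,X_n)=R_g^{(0)}[X'_1,..,X'_n]$ ($X'_i=X_i^\uparrow$ if $\varepsilon_g(i)=1$, $X_i$ if $\partial$); it is a complete lattice expansion in which each $f$, $g$ has residuals/Galois adjoints $f^\sharp_i,g^\flat_i$ in every coordinate ($f(\bar a)\le b\iff a_i\le f^\sharp_i(\bar a^i_b)$ if $\varepsilon_f(i)=1$, $\iff f^\sharp_i(\bar a^i_b)\le a_i$ if $\partial$; $b\le g(\bar a)\iff g^\flat_i(\bar a^i_b)\le a_i$ if $\varepsilon_g(i)=1$, $\iff a_i\le g^\flat_i(\bar a^i_b)$ if $\partial$). An assignment maps atoms to elements and extends homomorphically to structures, interpreting $\mathsf{F}_h,\mathsf{G}_h$ by the operation $h$, $f^\sharp_i$ or $g^\flat_i$. $\mathbb{F}_{\mathrm{D}}^+\models x\Rightarrow y$ means $v(x)\subseteq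 v(y)$ for every assignment $v$. -}

module Defs where

open import Level using (Level)
open import Data.Nat using (ℕ; zero; suc; _+_; _≤_)
open import Data.Fin using (Fin; zero; suc; _≟_)
open import Data.Vec using (Vec; []; _∷_; lookup)
open import Data.Bool using (Bool; true; false; if_then_else_)
open import Data.Product using (Σ; ∃; _×_; _,_; proj₁; proj₂)
open import Data.Sum using (_⊎_; inj₁; inj₂)
open import Data.Empty using (⊥)
open import Data.Unit using (⊤; tt)
open import Relation.Nullary using (¬_; does; yes; no)
open import Relation.Binary.PropositionalEquality using (_≡_; refl; subst; cong; trans; sym)
open import Function.Bundles using (_⇔_)

data Pol : Set where
  one : Pol
  ∂   : Pol

_ᵖ : Pol → Pol
one ᵖ = ∂
∂ ᵖ = one

data Srt : Set where
  sF : Srt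
  sG : Srt

sortF : Pol → Srt
sortF one = sF
sortF ∂ = sG

sortG : Pol → Srt
sortG one = sG
sortG ∂ = sF

upd : ∀ {a} {A : Set a} {n : ℕ} → (Fin n → A) → Fin n → A → Fin n → A
upd s zero a zero = a
upd s zero a (suc j) = s (suc j)
upd s (suc i) a zero = s zero
upd s (suc i) a (suc j) = upd (λ k → s (suc k)) i a j

-- LE-signatures L(F,G) (F, G are disjoint by construction: two index types)

record Sig : Set₁ where
  field
    Atom : Set
    FC   : Set
    GC   : Set
    arF  : FC → ℕ
    arG  : GC → ℕ
    εF   : (f : FC) → Fin (arF f) → Pol
    εG   : (g : GC) → Fin (arG g) → Pol

module _ (L : Sig) where
  open Sig L

  data Fm : Set where
    var  : Atom → Fm
    bot  : Fm
    top  : Fm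
    _∧ᶠ_ : Fm → Fm → Fm
    _∨ᶠ_ : Fm → Fm → Fm
    fapp : (f : FC) → Vec Fm (arF f) → Fm
    gapp : (g : GC) → Vec Fm (arG g) → Fm

  data HF : Set where
    baseF  : FC → HF
    sharpF : (f : FC) (i : Fin (arF f)) → εF f i ≡ ∂ → HF
    flatF  : (g : GC) (i : Fin (arG g)) → εG g i ≡ one → HF

  data HG : Set where
    baseG  : GC → HG
    sharpG : (f : FC) (i : Fin (arF f)) → εF f i ≡ one → HG
    flatG  : (g : GC) (i : Fin (arG g)) → εG g i ≡ ∂ → HG

  arHF : HF → ℕ
  arHF (baseF f) = arF f
  arHF (sharpF f i _) = arF f
  arHF (flatF g i _) = arG g

  arHG : HG → ℕ
  arHG (baseG g) = arG g
  arHG (sharpG f i _) = arF f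
  arHG (flatG g i _) = arG g

  εHF : (h : HF) → Fin (arHF h) → Pol
  εHF (baseF f) = εF f
  εHF (sharpF f i _) = εF f
  εHF (flatF g i _) = upd (λ j → εG g j ᵖ) i (εG g i)

  εHG : (h : HG) → Fin (arHG h) → Pol
  εHG (baseG g) = εG g
  εHG (sharpG f i _) = upd (λ j → εF f j ᵖ) i (εF f i)
  εHG (flatG g i _) = εG g

  srtBaseF : (f : FC) → Fin (arF f) → Srt
  srtBaseF f j = sortF (εF f j)

  srtBaseG : (g : GC) → Fin (arG g) → Srt
  srtBaseG g j = sortG (εG g j)

  -- For residual symbols we use
  -- "sorts of the base connective with position i set to the sort of the new
  -- occupant" (this makes x̄^i_y well typed); lemma sorts-agree below shows it
  -- coincides with the sorts determined by εHF / εHG.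
  srtHF : (h : HF) → Fin (arHF h) → Srt
  srtHF (baseF f) = srtBaseF f
  srtHF (sharpF f i _) = upd (srtBaseF f) i sG
  srtHF (flatF g i _) = upd (srtBaseG g) i sF

  srtHG : (h : HG) → Fin (arHG h) → Srt
  srtHG (baseG g) = srtBaseG g
  srtHG (sharpG f i _) = upd (srtBaseF f) i sG
  srtHG (flatG g i _) = upd (srtBaseG g) i sF

  -- structures: St sF = Str_F, St sG = Str_G (both contain all formulas)
  mutual
    data St : Srt → Set where
      ι  : ∀ {s} → Fm → St s
      FS : (h : HF) → Args (arHF h) (srtHF h) → St sF
      GS : (h : HG) → Args (arHG h) (srtHG h) → St sG

    data Args : (n : ℕ) → (Fin n → Srt) → Set where
      []ᵃ  : ∀ {s} → Args zero s
      _∷ᵃ_ : ∀ {n s} → St (s zero) → Args n (λ j → s (suc j)) → Args (suc n) s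

  lookupA : ∀ {n s} → Args n s → (i : Fin n) → St (s i)
  lookupA (x ∷ᵃ xs) zero = x
  lookupA (x ∷ᵃ xs) (suc i) = lookupA xs i

  setA : ∀ {n s t} → Args n s → (i : Fin n) → St t → Args n (upd s i t)
  setA (x ∷ᵃ xs) zero y = y ∷ᵃ xs
  setA (x ∷ᵃ xs) (suc i) y = x ∷ᵃ setA xs i y

  fmArgs : ∀ {n s} → Vec Fm n → Args n s
  fmArgs [] = []ᵃ
  fmArgs (φ ∷ φs) = ι φ ∷ᵃ fmArgs φs

  -- schematic structures (structure variables of each sort) for structural rules

  mutual
    data SSt (nF nG : ℕ) : Srt → Set where
      svF : Fin nF → SSt nF nG sF
      svG : Fin nG → SSt nF nG sG
      sFS : (h : HF) → SArgs nF nG (arHF h) (srtHF h) → SSt nF nG sF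
      sGS : (h : HG) → SArgs nF nG (arHG h) (srtHG h) → SSt nF nG sG

    data SArgs (nF nG : ℕ) : (n : ℕ) → (Fin n → Srt) → Set where
      []ˢ  : ∀ {s} → SArgs nF nG zero s
      _∷ˢ_ : ∀ {n s} → SSt nF nG (s zero) → SArgs nF nG n (λ j → s (suc j))
             → SArgs nF nG (suc n) s

  mutual
    inst : ∀ {nF nG s} → (Fin nF → St sF) → (Fin nG → St sG) → SSt nF nG s → St s
    inst σF σG (svF j) = σF j
    inst σF σG (svG j) = σG j
    inst σF σG (sFS h as) = FS h (instA σF σG as)
    inst σF σG (sGS h as) = GS h (instA σF σG as)

    instA : ∀ {nF nG n s} → (Fin nF → St sF) → (Fin nG → St sG) → SArgs nF nG n s → Args n s
    instA σF σG []ˢ = []ᵃ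
    instA σF σG (a ∷ˢ as) = inst σF σG a ∷ᵃ instA σF σG as

  mutual
    occF : ∀ {nF nG s} → SSt nF nG s → Fin nF → ℕ
    occF (svF j') j = if does (j' ≟ j) then 1 else 0
    occF (svG j') j = 0
    occF (sFS h as) j = occFA as j
    occF (sGS h as) j = occFA as j

    occFA : ∀ {nF nG n s} → SArgs nF nG n s → Fin nF → ℕ
    occFA []ˢ j = 0
    occFA (a ∷ˢ as) j = occF a j + occFA as j

  mutual
    occG : ∀ {nF nG s} → SSt nF nG s → Fin nG → ℕ
    occG (svF j') j = 0
    occG (svG j') j = if does (j' ≟ j) then 1 else 0
    occG (sFS h as) j = occGA as j
    occG (sGS h as) j = occGA as j

    occGA : ∀ {nF nG n s} → SArgs nF nG n s → Fin nG → ℕ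
    occGA []ˢ j = 0
    occGA (a ∷ˢ as) j = occG a j + occGA as j

  record StructRule : Set where
    field
      nF nG k : ℕ
      prem   : Fin k → SSt nF nG sF × SSt nF nG sG
      concl  : SSt nF nG sF × SSt nF nG sG

  -- analyticity (Belnap C1–C7 for a purely structural scheme with sorted
  -- schematic variables): C3, non-proliferation: every
  -- structure variable occurs at most once in the conclusion.
  Analytic : StructRule → Set
  Analytic r =
    (∀ j → occF (proj₁ concl) j + occF (proj₂ concl) j ≤ 1) ×
    (∀ j → occG (proj₁ concl) j + occG (proj₂ concl) j ≤ 1)
    where open StructRule r

  -- the calculi D.LE (withCut = true, no extra rules), cfD.LE (withCut = false),
  -- D.LE' / cfD.LE' (extra analytic structural rules indexed by Idx)
  record Calc : Set₁ where
    field
      withCut  : Bool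
      Idx      : Set
      rules    : Idx → StructRule
      analytic : ∀ i → Analytic (rules i)

  -- functional D-frames: W = St sF, U = St sG, N ⊆ W × U closed under rules

  module _ (N : St sF → St sG → Set) where

    Prem : ∀ {t} → St t → Fm → Set
    Prem {sF} x φ = N x (ι φ)
    Prem {sG} y φ = N (ι φ) y

    record ClosedDLE : Set where
      field
        Id    : ∀ p → N (ι (var p)) (ι (var p))
        dispF1 : ∀ f i (e : εF f i ≡ one) (xs : Args (arF f) (srtBaseF f)) (y : St sG) →
                 N (FS (baseF f) xs) y ⇔
                 N (subst St (cong sortF e) (lookupA xs i)) (GS (sharpG f i e) (setA xs i y))
        dispF∂ : ∀ f i (e : εF f i ≡ ∂) (xs : Args (arF f) (srtBaseF f)) (y : St sG) →
                 N (FS (baseF f) xs) y ⇔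
                 N (FS (sharpF f i e) (setA xs i y)) (subst St (cong sortF e) (lookupA xs i))
        dispG1 : ∀ g i (e : εG g i ≡ one) (ys : Args (arG g) (srtBaseG g)) (x : St sF) →
                 N x (GS (baseG g) ys) ⇔
                 N (FS (flatF g i e) (setA ys i x)) (subst St (cong sortG e) (lookupA ys i))
        dispG∂ : ∀ g i (e : εG g i ≡ ∂) (ys : Args (arG g) (srtBaseG g)) (x : St sF) →
                 N x (GS (baseG g) ys) ⇔
                 N (subst St (cong sortG e) (lookupA ys i)) (GS (flatG g i e) (setA ys i x))
        botL  : ∀ y → N (ι bot) y
        topR  : ∀ x → N x (ι top)
        ∧L₁   : ∀ φ ψ y → N (ι φ) y → N (ι (φ ∧ᶠ ψ)) y
        ∧L₂   : ∀ φ ψ y → N (ι φ) y → N (ι (ψ ∧ᶠ φ)) y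
        ∨R₁   : ∀ φ ψ x → N x (ι φ) → N x (ι (φ ∨ᶠ ψ))
        ∨R₂   : ∀ φ ψ x → N x (ι φ) → N x (ι (ψ ∨ᶠ φ))
        ∧R    : ∀ φ ψ x → N x (ι φ) → N x (ι ψ) → N x (ι (φ ∧ᶠ ψ))
        ∨L    : ∀ φ ψ y → N (ι φ) y → N (ι ψ) y → N (ι (φ ∨ᶠ ψ)) y
        fL    : ∀ f (φs : Vec Fm (arF f)) y → N (FS (baseF f) (fmArgs φs)) y → N (ι (fapp f φs)) y
        fR    : ∀ f (φs : Vec Fm (arF f)) (xs : Args (arF f) (srtBaseF f)) →
                (∀ i → Prem (lookupA xs i) (lookup φs i)) → N (FS (baseF f) xs) (ι (fapp f φs))
        gR    : ∀ g (ψs : Vec Fm (arG g)) x → N x (GS (baseG g) (fmArgs ψs)) → N x (ι (gapp g ψs))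
        gL    : ∀ g (ψs : Vec Fm (arG g)) (ys : Args (arG g) (srtBaseG g)) →
                (∀ i → Prem (lookupA ys i) (lookup ψs i)) → N (ι (gapp g ψs)) (GS (baseG g) ys)

    record IsFunctionalFrame (D : Calc) : Set where
      open Calc D
      field
        closedDLE : ClosedDLE
        closedCut : withCut ≡ true → ∀ x φ y → N x (ι φ) → N (ι φ) y → N x y
        closedExtra : ∀ (r : Idx) → let open StructRule (rules r) in
          ∀ (σF : Fin nF → St sF) (σG : Fin nG → St sG) →
          (∀ j → N (inst σF σG (proj₁ (prem j))) (inst σF σG (proj₂ (prem j)))) →
          N (inst σF σG (proj₁ concl)) (inst σF σG (proj₂ concl))

    Rf : (f : FC) → St sG → Args (arF f) (srtBaseF f) → Set
    Rf f y xs = N (FS (baseF f) xs) y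

    Rg : (g : GC) → St sF → Args (arG g) (srtBaseG g) → Set
    Rg g x ys = N x (GS (baseG g) ys)

    -- complex algebra F⁺: stable subsets of W

    Pred : Set₁
    Pred = St sF → Set

    _↑ : Pred → St sG → Set
    (X ↑) u = ∀ x → X x → N x u

    _↓ : (St sG → Set) → Pred
    (Y ↓) w = ∀ y → Y y → N w y

    _⊆_ : Pred → Pred → Set
    X ⊆ Y = ∀ x → X x → Y x

    Stable : Pred → Set
    Stable X = (X ⊆ ((X ↑) ↓)) × (((X ↑) ↓) ⊆ X)

    mem : ∀ {t} → Pred → St t → Set
    mem {sF} X x = X x
    mem {sG} X y = (X ↑) y

    fop : (f : FC) → (Fin (arF f) → Pred) → Pred
    fop f X = (λ u → ∀ xs → (∀ i → mem (X i) (lookupA xs i)) → Rf f u xs) ↓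

    gop : (g : GC) → (Fin (arG g) → Pred) → Pred
    gop g X = λ w → ∀ ys → (∀ i → mem (X i) (lookupA ys i)) → Rg g w ys

    -- principal elements {w}^↑↓ (join-dense) and {u}^↓ (meet-dense)
    cl : St sF → Pred
    cl w = λ x → ∀ u → N w u → N x u

    co : St sG → Pred
    co u = λ x → N x u

    -- residuals / Galois adjoints, as joins / meets in the lattice of stable sets
    -- (argument vector c = ā^i_b):
    --  f♯_i, ε_f(i)=∂ : least a with f(ā^i_a) ≤ b     (meet)
    --  g♭_i, ε_g(i)=1 : least a with b ≤ g(ā^i_a)     (meet)
    --  f♯_i, ε_f(i)=1 : greatest a with f(ā^i_a) ≤ b  (join)
    --  g♭_i, ε_g(i)=∂ : greatest a with b ≤ g(ā^i_a)  (join)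
    opF : (h : HF) → (Fin (arHF h) → Pred) → Pred
    opF (baseF f) c = fop f c
    opF (sharpF f i _) c = λ x → ∀ u → fop f (upd c i (co u)) ⊆ c i → N x u
    opF (flatF g i _) c = λ x → ∀ u → c i ⊆ gop g (upd c i (co u)) → N x u

    opG : (h : HG) → (Fin (arHG h) → Pred) → Pred
    opG (baseG g) c = gop g c
    opG (sharpG f i _) c =
      ((λ x → ∃ λ w → (fop f (upd c i (cl w)) ⊆ c i) × cl w x) ↑) ↓
    opG (flatG g i _) c =
      ((λ x → ∃ λ w → (c i ⊆ gop g (upd c i (cl w))) × cl w x) ↑) ↓

    module _ (v : Atom → Pred) where
      mutual
        ⟦_⟧ᶠ : Fm → Pred
        ⟦ var p ⟧ᶠ = v p
        ⟦ bot ⟧ᶠ = ((λ _ → ⊥) ↑) ↓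
        ⟦ top ⟧ᶠ = λ _ → ⊤
        ⟦ φ ∧ᶠ ψ ⟧ᶠ = λ x → ⟦ φ ⟧ᶠ x × ⟦ ψ ⟧ᶠ x
        ⟦ φ ∨ᶠ ψ ⟧ᶠ = ((λ x → ⟦ φ ⟧ᶠ x ⊎ ⟦ ψ ⟧ᶠ x) ↑) ↓
        ⟦ fapp f φs ⟧ᶠ = fop f ⟦ φs ⟧ᵛ
        ⟦ gapp g φs ⟧ᶠ = gop g ⟦ φs ⟧ᵛ

        ⟦_⟧ᵛ : ∀ {n} → Vec Fm n → Fin n → Pred
        ⟦ φ ∷ φs ⟧ᵛ zero = ⟦ φ ⟧ᶠ
        ⟦ φ ∷ φs ⟧ᵛ (suc i) = ⟦ φs ⟧ᵛ i

      mutual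
        ⟦_⟧ : ∀ {s} → St s → Pred
        ⟦ ι φ ⟧ = ⟦ φ ⟧ᶠ
        ⟦ FS h xs ⟧ = opF h ⟦ xs ⟧ᵃ
        ⟦ GS h ys ⟧ = opG h ⟦ ys ⟧ᵃ

        ⟦_⟧ᵃ : ∀ {n s} → Args n s → Fin n → Pred
        ⟦ x ∷ᵃ xs ⟧ᵃ zero = ⟦ x ⟧
        ⟦ x ∷ᵃ xs ⟧ᵃ (suc i) = ⟦ xs ⟧ᵃ i

    Valid : St sF → St sG → Set₁
    Valid x y = ∀ (v : Atom → Pred) → (∀ p → Stable (v p)) → ⟦ v ⟧ x ⊆ ⟦ v ⟧ y

  -- sanity: the argument sorts used above agree with those determined by
  -- the paper's order types of the residual symbols

  upd-≡ : ∀ {A : Set} {n} (s : Fin n → A) i a → upd s i a i ≡ a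
  upd-≡ s zero a = refl
  upd-≡ s (suc i) a = upd-≡ (λ k → s (suc k)) i a

  upd-≢ : ∀ {A : Set} {n} (s : Fin n → A) i a j → ¬ (j ≡ i) → upd s i a j ≡ s j
  upd-≢ s zero a zero ne with ne refl
  ... | ()
  upd-≢ s zero a (suc j) ne = refl
  upd-≢ s (suc i) a zero ne = refl
  upd-≢ s (suc i) a (suc j) ne = upd-≢ (λ k → s (suc k)) i a j (λ eq → ne (cong suc eq))

  sortFᵖ : ∀ p → sortF (p ᵖ) ≡ sortG p
  sortFᵖ one = refl
  sortFᵖ ∂ = refl

  sortGᵖ : ∀ p → sortG (p ᵖ) ≡ sortF p
  sortGᵖ one = refl
  sortGᵖ ∂ = refl

  sorts-agreeF : ∀ h j → srtHF h j ≡ sortF (εHF h j)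
  sorts-agreeF (baseF f) j = refl
  sorts-agreeF (sharpF f i e) j with j ≟ i
  ... | yes refl = trans (upd-≡ (srtBaseF f) i sG) (sym (cong sortF e))
  ... | no ne = upd-≢ (srtBaseF f) i sG j ne
  sorts-agreeF (flatF g i e) j with j ≟ i
  ... | yes refl = trans (upd-≡ (srtBaseG g) i sF)
                     (sym (trans (cong sortF (upd-≡ (λ k → εG g k ᵖ) i (εG g i))) (cong sortF e)))
  ... | no ne = trans (upd-≢ (srtBaseG g) i sF j ne)
                  (sym (trans (cong sortF (upd-≢ (λ k → εG g k ᵖ) i (εG g i) j ne)) (sortFᵖ (εG g j))))

  sorts-agreeG : ∀ h j → srtHG h j ≡ sortG (εHG h j)
  sorts-agreeG (baseG g) j = refl
  sorts-agreeG (sharpG f i e) j with j ≟ i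
  ... | yes refl = trans (upd-≡ (srtBaseF f) i sG)
                     (sym (trans (cong sortG (upd-≡ (λ k → εF f k ᵖ) i (εF f i))) (cong sortG e)))
  ... | no ne = trans (upd-≢ (srtBaseF f) i sG j ne)
                  (sym (trans (cong sortG (upd-≢ (λ k → εF f k ᵖ) i (εF f i) j ne)) (sortGᵖ (εF f j))))
  sorts-agreeG (flatG g i e) j with j ≟ i
  ... | yes refl = trans (upd-≡ (srtBaseG g) i sF) (sym (cong sortG e))
  ... | no ne = upd-≢ (srtBaseG g) i sF j ne

module Submission where

-- The proof evaluates the sequent under the canonical assignment
-- v₀(p) = {p}^↑↓ and shows that every structure lies in its own meaning:
-- for x : Str_F we get x ∈ ⟦x⟧, and for y : Str_G we get ⟦y⟧ ⊆ {y}^↓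
-- (uniformly: t ∈ ⟦t⟧′, where X′ is X on Str_F and X^↑ on Str_G, as in
-- the definition of f and g on F⁺).  Then x ∈ ⟦x⟧ ⊆ ⟦y⟧ gives x N y.
--
-- Only the D.LE rules without Cut are needed, so the result holds for all
-- four calculi D.LE, cfD.LE, D.LE′, cfD.LE′ alike.

open import Defs
open import Data.Fin using (Fin; zero; suc)
open import Data.Vec using (Vec; _∷_; lookup)
open import Data.Product using (_,_; proj₁; proj₂)
open import Data.Sum using (inj₁; inj₂)
open import Data.Unit using (tt)
open import Relation.Binary.PropositionalEquality using (_≡_; refl; subst; subst₂; cong; trans; sym)
open import Relation.Binary.PropositionalEquality.Properties using (subst-subst-sym)
open import Function.Bundles using (Equivalence)

-- Argument tuples whose i-th coordinate was replaced by an entry of sort t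
-- (the arguments of a residual structural connective) split into that
-- entry and a tuple of the original sorts.
module Tuples (L : Sig) where

  entryAt : ∀ {n s t} (i : Fin n) → Args L n (upd s i t) → St L t
  entryAt zero (x ∷ᵃ xs) = x
  entryAt {s = s} (suc i) (x ∷ᵃ xs) = entryAt {s = λ k → s (suc k)} i xs

  refill : ∀ {n s t} (i : Fin n) → Args L n (upd s i t) → St L (s i) → Args L n s
  refill zero (x ∷ᵃ xs) z = z ∷ᵃ xs
  refill {s = s} (suc i) (x ∷ᵃ xs) z = x ∷ᵃ refill {s = λ k → s (suc k)} i xs z

  setA-refill : ∀ {n s t} (i : Fin n) (xs : Args L n (upd s i t)) (z : St L (s i)) →
                setA L (refill {s = s} i xs z) i (entryAt {s = s} i xs) ≡ xs
  setA-refill zero (x ∷ᵃ xs) z = refl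
  setA-refill {s = s} (suc i) (x ∷ᵃ xs) z = cong (x ∷ᵃ_) (setA-refill {s = λ k → s (suc k)} i xs z)

  lookupA-refill : ∀ {n s t} (i : Fin n) (xs : Args L n (upd s i t)) (z : St L (s i)) →
                   lookupA L (refill {s = s} i xs z) i ≡ z
  lookupA-refill zero (x ∷ᵃ xs) z = refl
  lookupA-refill {s = s} (suc i) (x ∷ᵃ xs) z = lookupA-refill {s = λ k → s (suc k)} i xs z

  -- the form in which the display rules read the refilled coordinate back:
  -- a structure u of sort r, transported to sort s i and back
  lookupA-refill-transport : ∀ {n s t r} (i : Fin n) (xs : Args L n (upd s i t)) (p : s i ≡ r)
                             (u : St L r) →
                             subst (St L) p (lookupA L (refill {s = s} i xs (subst (St L) (sym p) u)) i) ≡ u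
  lookupA-refill-transport {s = s} i xs p u =
    trans (cong (subst (St L) p) (lookupA-refill {s = s} i xs (subst (St L) (sym p) u)))
          (subst-subst-sym p)

module Frame (L : Sig) (N : St L sF → St L sG → Set) where
  open Sig L using (arF; arG)
  open Tuples L

  Pr : Set₁
  Pr = Pred L N

  _∈′_ : ∀ {t} → St L t → Pr → Set
  t ∈′ X = mem L N X t

  AllIn : ∀ {n s} → Args L n s → (Fin n → Pr) → Set
  AllIn xs X = ∀ j → lookupA L xs j ∈′ X j

  ↓-closed : (Y : St L sG → Set) → _⊆_ L N (_↓ L N (_↑ L N (_↓ L N Y))) (_↓ L N Y)
  ↓-closed Y x h y yY = h y (λ w wY → wY y yY)

  cl-stable : (w : St L sF) → Stable L N (cl L N w)
  cl-stable w = (λ x xw u uX → uX x xw) , (λ x h u wu → h u (λ z zw → zw u wu))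

  ι-in : ∀ {t} (X : Pr) (φ : Fm L) → X (ι φ) → _⊆_ L N X (co L N (ι φ)) → ι {s = t} φ ∈′ X
  ι-in {sF} X φ φ∈X X⊆φ↓ = φ∈X
  ι-in {sG} X φ φ∈X X⊆φ↓ = X⊆φ↓

  ∈′-prem : ∀ {t} (X : Pr) (φ : Fm L) (z : St L t) → X (ι φ) → _⊆_ L N X (co L N (ι φ)) →
            z ∈′ X → Prem L N z φ
  ∈′-prem {sF} X φ z φ∈X X⊆φ↓ z∈X = X⊆φ↓ z z∈X
  ∈′-prem {sG} X φ z φ∈X X⊆φ↓ z∈X↑ = z∈X↑ (ι φ) φ∈X

  co-in : ∀ {t} (p : sG ≡ t) (u : St L sG) → subst (St L) p u ∈′ co L N u
  co-in refl u = λ x xNu → xNu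

  cl-in : ∀ {t} (p : sF ≡ t) (w : St L sF) → subst (St L) p w ∈′ cl L N w
  cl-in refl w = λ u wNu → wNu

  entryAt-in : ∀ {n s t} (X : Fin n → Pr) (i : Fin n) (xs : Args L n (upd s i t)) →
               AllIn xs X → entryAt {s = s} i xs ∈′ X i
  entryAt-in X zero (x ∷ᵃ xs) H = H zero
  entryAt-in {s = s} X (suc i) (x ∷ᵃ xs) H =
    entryAt-in {s = λ k → s (suc k)} (λ k → X (suc k)) i xs (λ j → H (suc j))

  refill-in : ∀ {n s t} (X : Fin n → Pr) (D : Pr) (i : Fin n) (xs : Args L n (upd s i t))
              (z : St L (s i)) → AllIn xs X → z ∈′ D → AllIn (refill {s = s} i xs z) (upd X i D)
  refill-in X D zero (x ∷ᵃ xs) z H z∈D zero = z∈D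
  refill-in X D zero (x ∷ᵃ xs) z H z∈D (suc j) = H (suc j)
  refill-in X D (suc i) (x ∷ᵃ xs) z H z∈D zero = H zero
  refill-in {s = s} X D (suc i) (x ∷ᵃ xs) z H z∈D (suc j) =
    refill-in {s = λ k → s (suc k)} (λ k → X (suc k)) D i xs z (λ j → H (suc j)) z∈D j

  fop-in : ∀ f (X : Fin (arF f) → Pr) (xs : Args L (arF f) (srtBaseF L f)) →
           AllIn xs X → FS (baseF f) xs ∈′ fop L N f X
  fop-in f X xs xs∈X u u∈R = u∈R xs xs∈X

  gop-in : ∀ g (X : Fin (arG g) → Pr) (ys : Args L (arG g) (srtBaseG L g)) →
           AllIn ys X → GS (baseG g) ys ∈′ gop L N g X
  gop-in g X ys ys∈X x x∈g = x∈g ys ys∈X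

module Canonical (L : Sig) (N : St L sF → St L sG → Set) (C : ClosedDLE L N) where
  open Sig L
  open ClosedDLE C
  open Tuples L
  open Frame L N

  v₀ : Atom → Pr
  v₀ p = cl L N (ι (var p))

  v₀-stable : ∀ p → Stable L N (v₀ p)
  v₀-stable p = cl-stable (ι (var p))

  ⟦_⟧f : Fm L → Pr
  ⟦ φ ⟧f = ⟦_⟧ᶠ L N v₀ φ

  record Represents (X : Pr) (φ : Fm L) : Set where
    field
      closed   : _⊆_ L N (_↓ L N (_↑ L N X)) X
      contains : X (ι φ)
      below    : _⊆_ L N X (co L N (ι φ))

  open Represents

  mutual
    represents : ∀ φ → Represents ⟦ φ ⟧f φ
    represents (var p) = record
      { closed = proj₂ (v₀-stable p) ; contains = λ u pNu → pNu ; below = λ x x∈ → x∈ _ (Id p) }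
    represents bot = record
      { closed = ↓-closed _ ; contains = λ y _ → botL y ; below = λ x x∈ → x∈ (ι bot) (λ z ()) }
    represents top = record
      { closed = λ x _ → tt ; contains = tt ; below = λ x _ → topR x }
    represents (φ ∧ᶠ ψ) = record
      { closed = λ x h → closed A x (λ u u∈ → h u (λ z z∈ → u∈ z (proj₁ z∈)))
                       , closed B x (λ u u∈ → h u (λ z z∈ → u∈ z (proj₂ z∈)))
      ; contains = closed A _ (λ u u∈ → ∧L₁ φ ψ u (u∈ _ (contains A)))
                 , closed B _ (λ u u∈ → ∧L₂ ψ φ u (u∈ _ (contains B)))
      ; below = λ x x∈ → ∧R φ ψ x (below A x (proj₁ x∈)) (below B x (proj₂ x∈)) }
      where A = represents φ ; B = represents ψ
    represents (φ ∨ᶠ ψ) = record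
      { closed = ↓-closed _
      ; contains = λ u u∈ → ∨L φ ψ u (u∈ _ (inj₁ (contains A))) (u∈ _ (inj₂ (contains B)))
      ; below = λ x x∈ → x∈ (ι (φ ∨ᶠ ψ)) λ { z (inj₁ z∈A) → ∨R₁ φ ψ z (below A z z∈A)
                                            ; z (inj₂ z∈B) → ∨R₂ ψ φ z (below B z z∈B) } }
      where A = represents φ ; B = represents ψ
    represents (fapp f φs) = record
      { closed = ↓-closed _
      ; contains = λ u u∈ → fL f φs u (u∈ (fmArgs L φs) (fmArgs-in (srtBaseF L f) φs))
      ; below = λ x x∈ → x∈ (ι (fapp f φs))
          (λ xs m → fR f φs xs (λ i → in-prem φs i (lookupA L xs i) (m i))) }
    represents (gapp g φs) = record
      { closed = λ x h ys m → h (GS (baseG g) ys) (λ z z∈ → z∈ ys m)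
      ; contains = λ ys m → gL g φs ys (λ i → in-prem φs i (lookupA L ys i) (m i))
      ; below = λ x x∈ → gR g φs x (x∈ (fmArgs L φs) (fmArgs-in (srtBaseG L g) φs)) }

    fmArgs-in : ∀ {n} (s : Fin n → Srt) (φs : Vec (Fm L) n) →
                AllIn (fmArgs L {s = s} φs) (⟦_⟧ᵛ L N v₀ φs)
    fmArgs-in s (φ ∷ φs) zero = ι-in {s zero} _ φ (contains (represents φ)) (below (represents φ))
    fmArgs-in s (φ ∷ φs) (suc i) = fmArgs-in (λ j → s (suc j)) φs i

    in-prem : ∀ {n} (φs : Vec (Fm L) n) (i : Fin n) {t} (z : St L t) →
              z ∈′ ⟦_⟧ᵛ L N v₀ φs i → Prem L N z (lookup φs i)
    in-prem (φ ∷ φs) zero z = ∈′-prem _ φ z (contains (represents φ)) (below (represents φ))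
    in-prem (φ ∷ φs) (suc i) z = in-prem φs i z

  -- In each case
  -- the defining inequality of the residual, instantiated at the principal
  -- set of the displayed structure, yields the sequent before the display
  -- step, and the display rule turns it into the required one.

  sharpF-in : ∀ f i (e : εF f i ≡ ∂) (X : Fin (arF f) → Pr)
              (xs : Args L (arF f) (srtHF L (sharpF f i e))) →
              AllIn xs X → FS (sharpF f i e) xs ∈′ opF L N (sharpF f i e) X
  sharpF-in f i e X xs xs∈X u fX⊆Xi =
    subst₂ N (cong (FS (sharpF f i e)) (setA-refill {s = srtBaseF L f} i xs z))
             (lookupA-refill-transport {s = srtBaseF L f} i xs p u)
             (Equivalence.to (dispF∂ f i e zs (entryAt {s = srtBaseF L f} i xs)) beforeDisplay)
    where
      p = cong sortF e
      z = subst (St L) (sym p) u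
      zs = refill {s = srtBaseF L f} i xs z
      beforeDisplay : N (FS (baseF f) zs) (entryAt {s = srtBaseF L f} i xs)
      beforeDisplay = entryAt-in {s = srtBaseF L f} X i xs xs∈X (FS (baseF f) zs)
        (fX⊆Xi _ (fop-in f _ zs
          (refill-in {s = srtBaseF L f} X (co L N u) i xs z xs∈X (co-in (sym p) u))))

  flatF-in : ∀ g i (e : εG g i ≡ one) (X : Fin (arG g) → Pr)
             (ys : Args L (arG g) (srtHF L (flatF g i e))) →
             AllIn ys X → FS (flatF g i e) ys ∈′ opF L N (flatF g i e) X
  flatF-in g i e X ys ys∈X u Xi⊆gX =
    subst₂ N (cong (FS (flatF g i e)) (setA-refill {s = srtBaseG L g} i ys z))
             (lookupA-refill-transport {s = srtBaseG L g} i ys p u)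
             (Equivalence.to (dispG1 g i e zs (entryAt {s = srtBaseG L g} i ys)) beforeDisplay)
    where
      p = cong sortG e
      z = subst (St L) (sym p) u
      zs = refill {s = srtBaseG L g} i ys z
      beforeDisplay : N (entryAt {s = srtBaseG L g} i ys) (GS (baseG g) zs)
      beforeDisplay = Xi⊆gX _ (entryAt-in {s = srtBaseG L g} X i ys ys∈X) zs
        (refill-in {s = srtBaseG L g} X (co L N u) i ys z ys∈X (co-in (sym p) u))

  -- f♯_i (ε_f(i) = 1): the greatest a with f(X̄^i_a) ≤ X_i, a join of
  -- principal sets {w}^↑↓; each such w is below the structure
  sharpG-in : ∀ f i (e : εF f i ≡ one) (X : Fin (arF f) → Pr)
              (xs : Args L (arF f) (srtHG L (sharpG f i e))) →
              AllIn xs X → GS (sharpG f i e) xs ∈′ opG L N (sharpG f i e) X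
  sharpG-in f i e X xs xs∈X x x∈ =
    x∈ (GS (sharpG f i e) xs) λ { z (w , fX⊆Xi , z∈w) → z∈w _ (below-w w fX⊆Xi) }
    where
      below-w : ∀ w → _⊆_ L N (fop L N f (upd X i (cl L N w))) (X i) → N w (GS (sharpG f i e) xs)
      below-w w fX⊆Xi =
        subst₂ N (lookupA-refill-transport {s = srtBaseF L f} i xs p w)
                 (cong (GS (sharpG f i e)) (setA-refill {s = srtBaseF L f} i xs z))
                 (Equivalence.to (dispF1 f i e zs (entryAt {s = srtBaseF L f} i xs)) beforeDisplay)
        where
          p = cong sortF e
          z = subst (St L) (sym p) w
          zs = refill {s = srtBaseF L f} i xs z
          beforeDisplay : N (FS (baseF f) zs) (entryAt {s = srtBaseF L f} i xs)
          beforeDisplay = entryAt-in {s = srtBaseF L f} X i xs xs∈X (FS (baseF f) zs)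
            (fX⊆Xi _ (fop-in f _ zs
              (refill-in {s = srtBaseF L f} X (cl L N w) i xs z xs∈X (cl-in (sym p) w))))

  flatG-in : ∀ g i (e : εG g i ≡ ∂) (X : Fin (arG g) → Pr)
             (ys : Args L (arG g) (srtHG L (flatG g i e))) →
             AllIn ys X → GS (flatG g i e) ys ∈′ opG L N (flatG g i e) X
  flatG-in g i e X ys ys∈X x x∈ =
    x∈ (GS (flatG g i e) ys) λ { z (w , Xi⊆gX , z∈w) → z∈w _ (below-w w Xi⊆gX) }
    where
      below-w : ∀ w → _⊆_ L N (X i) (gop L N g (upd X i (cl L N w))) → N w (GS (flatG g i e) ys)
      below-w w Xi⊆gX =
        subst₂ N (lookupA-refill-transport {s = srtBaseG L g} i ys p w)
                 (cong (GS (flatG g i e)) (setA-refill {s = srtBaseG L g} i ys z))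
                 (Equivalence.to (dispG∂ g i e zs (entryAt {s = srtBaseG L g} i ys)) beforeDisplay)
        where
          p = cong sortG e
          z = subst (St L) (sym p) w
          zs = refill {s = srtBaseG L g} i ys z
          beforeDisplay : N (entryAt {s = srtBaseG L g} i ys) (GS (baseG g) zs)
          beforeDisplay = Xi⊆gX _ (entryAt-in {s = srtBaseG L g} X i ys ys∈X) zs
            (refill-in {s = srtBaseG L g} X (cl L N w) i ys z ys∈X (cl-in (sym p) w))

  opF-in : ∀ h (X : Fin (arHF L h) → Pr) (xs : Args L (arHF L h) (srtHF L h)) →
           AllIn xs X → FS h xs ∈′ opF L N h X
  opF-in (baseF f) = fop-in f
  opF-in (sharpF f i e) = sharpF-in f i e
  opF-in (flatF g i e) = flatF-in g i e

  opG-in : ∀ h (X : Fin (arHG L h) → Pr) (ys : Args L (arHG L h) (srtHG L h)) →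
           AllIn ys X → GS h ys ∈′ opG L N h X
  opG-in (baseG g) = gop-in g
  opG-in (sharpG f i e) = sharpG-in f i e
  opG-in (flatG g i e) = flatG-in g i e

  mutual
    self-in : ∀ {t} (x : St L t) → x ∈′ ⟦_⟧ L N v₀ x
    self-in {t} (ι φ) = ι-in {t} _ φ (contains (represents φ)) (below (represents φ))
    self-in (FS h xs) = opF-in h _ xs (self-inA xs)
    self-in (GS h ys) = opG-in h _ ys (self-inA ys)

    self-inA : ∀ {n s} (xs : Args L n s) → AllIn xs (⟦_⟧ᵃ L N v₀ xs)
    self-inA (x ∷ᵃ xs) zero = self-in x
    self-inA (x ∷ᵃ xs) (suc j) = self-inA xs j

proposition4p7 : (L : Sig) (D : Calc L) (N : St L sF → St L sG → Set) →
    IsFunctionalFrame L N D →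
    (x : St L sF) (y : St L sG) → Valid L N x y → N x y
proposition4p7 L D N frame x y valid = self-in y x (valid v₀ v₀-stable x (self-in x))
  where open Canonical L N (IsFunctionalFrame.closedDLE frame)
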